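{- Let $(S,d)$ be a $k$-center instance with $|S|=n$ in which every optimal cluster has size greater than $2\epsilon n$, let $\alpha\ge1$, let $d'$ be an $\alpha$-perturbation of $d$, and let $C'=\{c'_1,\dots,c'_k\}$ be a set of optimal centers under $d'$. Let $\mathcal{C}'$ be the set of $(\alpha,\epsilon)$-locally perturbation resilient optimal clusters. Then there exists a one-to-one function $f:\mathcal{C}'\to C'$ such that for every $C_i\in\mathcal{C}'$, $f(C_i)$ is the center (under $d'$, with respect to $C'$) of more than half of the points of $C_i$.
   Context: A $k$-center instance is a finite set $S$ with a metric $d$; for $X\subseteq S$, $|X|=k$, the cost is $\max_{v}\min_{x\in X}d(v,x)$, and the clustering induced by $X$ assigns each point to its closest center; the optimal clusters $C_1,\dots,C_k$ are those induced by an optimal center set under $d$. An $\alpha$-perturbation of $d$ is any $d'$ with $d(u,v)\le d'(u,v)\le\alpha d(u,v)$ for all $u,v$. Sets $A,B$ are $\epsilon$-close if $|A\setminus B|+|B\setminus A|\le\epsilon n$. An optimal cluster $C_i$ is $(\alpha,\epsilon)$-locally perturbation resilient if for every $\alpha$-perturbation $d'$, the optimal clustering under $d'$ contains a cluster $\epsilon$-close to $C_i$.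
   Formalization: The metric d, all its α-perturbations (including d′), and the parameters α and ε take rational values instead of real ones. -}

module Defs where

open import Data.Nat as ℕ using (ℕ; zero; suc)
open import Data.Integer using (+_)
open import Data.Rational using (ℚ; _/_; 0ℚ; _≤_; _<_; _⊓_; _⊔_; _*_; _+_)
open import Data.Fin using (Fin; zero; suc)
open import Data.Fin.Subset using (Subset; ∣_∣; _─_; _∩_)
open import Data.Vec using (tabulate)
open import Data.Bool using (Bool)
open import Relation.Nullary using (¬_; ⌊_⌋)
open import Relation.Binary.PropositionalEquality using (_≡_; _≢_)
open import Data.Product using (Σ; ∃; _×_; proj₁)
open import Function using (_∘_)
open import Data.Fin using (_≟_)

ℕtoℚ : ℕ → ℚ
ℕtoℚ m = + m / 1

Dist : ℕ → Set
Dist n = Fin n → Fin n → ℚ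

IsMetric : ∀ {n} → Dist n → Set
IsMetric {n} d =
  (∀ u → d u u ≡ 0ℚ) ×
  (∀ u v → u ≢ v → 0ℚ < d u v) ×
  (∀ u v → d u v ≡ d v u) ×
  (∀ u v w → d u w ≤ d u v + d v w)

-- minimum / maximum of a finite family of rationals (default 0 on empty family)
minF : ∀ {m} → (Fin m → ℚ) → ℚ
minF {zero} f = 0ℚ
minF {suc zero} f = f zero
minF {suc (suc m)} f = f zero ⊓ minF (f ∘ suc)

maxF : ∀ {m} → (Fin m → ℚ) → ℚ
maxF {zero} f = 0ℚ
maxF {suc zero} f = f zero
maxF {suc (suc m)} f = f zero ⊔ maxF (f ∘ suc)

CenterSet : ℕ → ℕ → Set
CenterSet n k = Σ (Fin k → Fin n) Injective′
  where
  Injective′ : (Fin k → Fin n) → Set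
  Injective′ X = ∀ {i j} → X i ≡ X j → i ≡ j

cost : ∀ {n k} → Dist n → (Fin k → Fin n) → ℚ
cost d X = maxF (λ v → minF (λ i → d v (X i)))

IsOptimal : ∀ {n k} → Dist n → CenterSet n k → Set
IsOptimal {n} {k} d X = ∀ (Y : CenterSet n k) → cost d (proj₁ X) ≤ cost d (proj₁ Y)

IsClosestAssignment : ∀ {n k} → Dist n → (Fin k → Fin n) → (Fin n → Fin k) → Set
IsClosestAssignment d X a = ∀ v j → d v (X (a v)) ≤ d v (X j)

cluster : ∀ {n k} → (Fin n → Fin k) → Fin k → Subset n
cluster a i = tabulate (λ v → ⌊ a v ≟ i ⌋)

EpsClose : ∀ {n} → ℚ → Subset n → Subset n → Set
EpsClose {n} ε A B = ℕtoℚ (∣ A ─ B ∣ ℕ.+ ∣ B ─ A ∣) ≤ ε * ℕtoℚ n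

IsPerturbation : ∀ {n} → ℚ → Dist n → Dist n → Set
IsPerturbation α d d′ = ∀ u v → (d u v ≤ d′ u v) × (d′ u v ≤ α * d u v)

LocallyPR : ∀ {n} → ℕ → Dist n → ℚ → ℚ → Subset n → Set
LocallyPR {n} k d α ε C =
  ∀ (d′ : Dist n) → IsPerturbation α d d′ →
  ∀ (Y : CenterSet n k) → IsOptimal d′ Y →
  ∀ (b : Fin n → Fin k) → IsClosestAssignment d′ (proj₁ Y) b →
  ∃ λ j → EpsClose ε (cluster b j) C

{-# OPTIONS --safe #-}
module Submission where

-- A locally perturbation resilient cluster Cᵢ is, by definition, ε-close to
-- some cluster of the d′-clustering; let f send Cᵢ to its index. Since
-- |Cᵢ| > 2εn, that cluster misses fewer than εn < |Cᵢ|/2 points of Cᵢ. If two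
-- distinct (hence disjoint) Cᵢ, Cⱼ had the same image B, then every point of
-- Cⱼ would lie in B ∖ Cᵢ or in Cⱼ ∖ B, giving |Cⱼ| ≤ 2εn.

open import Defs
open import Data.Nat using (ℕ; _≤_)
open import Data.Rational using (ℚ; 1ℚ; _<_; _*_) renaming (_≤_ to _≤ℚ_)
open import Data.Fin using (Fin)
open import Data.Fin.Subset using (∣_∣; _∩_)
open import Data.Product using (∃; _×_; proj₁)
open import Relation.Binary.PropositionalEquality using (_≡_)

import Data.Nat as ℕ
import Data.Nat.Properties as ℕ
open import Data.Integer as ℤ using (+_)
import Data.Integer.Properties as ℤ
open import Data.Rational using (mkℚ; _+_; *<*)
import Data.Rational.Properties as ℚ
import Data.Nat.Coprimality as Coprimality
open import Data.Bool.Properties using (T-≡)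
open import Data.Vec using ([]; _∷_; lookup)
open import Data.Vec.Properties using (lookup∘tabulate; []=⇒lookup)
open import Data.Fin.Subset using (Subset; _─_; _∈_; Empty; inside; outside)
open import Data.Fin.Subset.Properties using (x∈p∩q⁺; x∈p∩q⁻; x∈p∧x∉q⇒x∈p─q; p⊆q⇒∣p∣≤∣q∣)
open import Data.Product using (_,_; proj₂)
open import Function.Bundles using (Equivalence)
open import Relation.Binary.PropositionalEquality
  using (_≢_; refl; cong; cong₂; subst; subst₂; sym; trans; module ≡-Reasoning)
open import Relation.Nullary using (¬_; yes; no; ⌊_⌋; contradiction)
open import Relation.Nullary.Decidable using (toWitness)
import Data.Fin as Fin

ℕtoℚ≡mkℚ : ∀ m → ℕtoℚ m ≡ mkℚ (+ m) 0 (Coprimality.sym (Coprimality.1-coprimeTo m))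
ℕtoℚ≡mkℚ m = ℚ.normalize-coprime (Coprimality.sym (Coprimality.1-coprimeTo m))

ℕtoℚ-+ : ∀ p r → ℕtoℚ p + ℕtoℚ r ≡ ℕtoℚ (p ℕ.+ r)
ℕtoℚ-+ p r rewrite ℕtoℚ≡mkℚ p | ℕtoℚ≡mkℚ r =
  ℚ./-cong (cong₂ ℤ._+_ (ℤ.*-identityʳ (+ p)) (ℤ.*-identityʳ (+ r))) refl

ℕtoℚ-cancel-< : ∀ {p r} → ℕtoℚ p < ℕtoℚ r → p ℕ.< r
ℕtoℚ-cancel-< {p} {r} p<r rewrite ℕtoℚ≡mkℚ p | ℕtoℚ≡mkℚ r with p<r
... | *<* p<r = ℤ.drop‿+<+ (subst₂ ℤ._<_ (ℤ.*-identityʳ (+ p)) (ℤ.*-identityʳ (+ r)) p<r)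

two*x≡x+x : ∀ x → ℕtoℚ 2 * x ≡ x + x
two*x≡x+x x = trans (ℚ.*-distribʳ-+ x 1ℚ 1ℚ) (cong₂ _+_ (ℚ.*-identityˡ x) (ℚ.*-identityˡ x))

+-<-twice-bound : ∀ p r {c} (x y : ℚ) → ℕtoℚ p ≤ℚ x * y → ℕtoℚ r ≤ℚ x * y →
                  ℕtoℚ 2 * x * y < ℕtoℚ c → p ℕ.+ r ℕ.< c
+-<-twice-bound p r {c} x y p≤xy r≤xy 2xy<c = ℕtoℚ-cancel-< (begin-strict
  ℕtoℚ (p ℕ.+ r)      ≡⟨ ℕtoℚ-+ p r ⟨
  ℕtoℚ p + ℕtoℚ r     ≤⟨ ℚ.+-mono-≤ p≤xy r≤xy ⟩
  x * y + x * y       ≡⟨ two*x≡x+x (x * y) ⟨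
  ℕtoℚ 2 * (x * y)    ≡⟨ ℚ.*-assoc (ℕtoℚ 2) x y ⟨
  ℕtoℚ 2 * x * y      <⟨ 2xy<c ⟩
  ℕtoℚ c              ∎)
  where open ℚ.≤-Reasoning

∣p∣≡∣p∩q∣+∣p─q∣ : ∀ {n} (p q : Subset n) → ∣ p ∣ ≡ ∣ p ∩ q ∣ ℕ.+ ∣ p ─ q ∣
∣p∣≡∣p∩q∣+∣p─q∣ [] [] = refl
∣p∣≡∣p∩q∣+∣p─q∣ (inside ∷ p) (inside ∷ q) = cong ℕ.suc (∣p∣≡∣p∩q∣+∣p─q∣ p q)
∣p∣≡∣p∩q∣+∣p─q∣ (inside ∷ p) (outside ∷ q) =
  trans (cong ℕ.suc (∣p∣≡∣p∩q∣+∣p─q∣ p q)) (sym (ℕ.+-suc _ _))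
∣p∣≡∣p∩q∣+∣p─q∣ (outside ∷ p) (inside ∷ q) = ∣p∣≡∣p∩q∣+∣p─q∣ p q
∣p∣≡∣p∩q∣+∣p─q∣ (outside ∷ p) (outside ∷ q) = ∣p∣≡∣p∩q∣+∣p─q∣ p q

∣q∩r∣≤∣r─p∣ : ∀ {n} {p q : Subset n} (r : Subset n) → Empty (p ∩ q) → ∣ q ∩ r ∣ ≤ ∣ r ─ p ∣
∣q∩r∣≤∣r─p∣ {p = p} {q} r p∩q≡∅ = p⊆q⇒∣p∣≤∣q∣ q∩r⊆r─p
  where
  q∩r⊆r─p : ∀ {x} → x ∈ q ∩ r → x ∈ r ─ p
  q∩r⊆r─p {x} x∈q∩r =
    let x∈q , x∈r = x∈p∩q⁻ q r x∈q∩r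
    in x∈p∧x∉q⇒x∈p─q x∈r (λ x∈p → p∩q≡∅ (x , x∈p∩q⁺ (x∈p , x∈q)))

-- EpsClose ε A B unfolds to ℕtoℚ ∣ A ⊖ B ∣ ≤ℚ ε * ℕtoℚ n.
∣_⊖_∣ : ∀ {n} → Subset n → Subset n → ℕ
∣ A ⊖ B ∣ = ∣ A ─ B ∣ ℕ.+ ∣ B ─ A ∣

module _ {n : ℕ} (ε : ℚ) (B C : Subset n) (B≈C : EpsClose ε B C)
         (C-large : ℕtoℚ 2 * ε * ℕtoℚ n < ℕtoℚ ∣ C ∣) where

  close⇒majority : ∣ C ∣ ℕ.< 2 ℕ.* ∣ C ∩ B ∣
  close⇒majority = begin-strict
    ∣ C ∣               ≡⟨ ∣C∣≡m+y ⟩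
    m ℕ.+ y             <⟨ ℕ.+-monoʳ-< m y<m ⟩
    m ℕ.+ m             ≡⟨ cong (m ℕ.+_) (ℕ.+-identityʳ m) ⟨
    2 ℕ.* m             ∎
    where
    open ℕ.≤-Reasoning
    m = ∣ C ∩ B ∣
    y = ∣ C ─ B ∣
    δ = ∣ B ⊖ C ∣
    y≤δ : y ≤ δ
    y≤δ = ℕ.m≤n+m y ∣ B ─ C ∣
    ∣C∣≡m+y : ∣ C ∣ ≡ m ℕ.+ y
    ∣C∣≡m+y = ∣p∣≡∣p∩q∣+∣p─q∣ C B
    y<m : y ℕ.< m
    y<m = ℕ.+-cancelʳ-< y y m (begin-strict
      y ℕ.+ y           ≤⟨ ℕ.+-mono-≤ y≤δ y≤δ ⟩
      δ ℕ.+ δ           <⟨ +-<-twice-bound δ δ ε (ℕtoℚ n) B≈C B≈C C-large ⟩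
      ∣ C ∣             ≡⟨ ∣C∣≡m+y ⟩
      m ℕ.+ y           ∎)

  close⇒intersects : ∀ {A} → EpsClose ε B A → ¬ Empty (A ∩ C)
  close⇒intersects {A} B≈A A∩C≡∅ = ℕ.n≮n ∣ C ∣ (begin-strict
    ∣ C ∣                        ≡⟨ ∣p∣≡∣p∩q∣+∣p─q∣ C B ⟩
    ∣ C ∩ B ∣ ℕ.+ ∣ C ─ B ∣      ≤⟨ ℕ.+-mono-≤ C∩B≤ (ℕ.m≤n+m _ _) ⟩
    ∣ B ⊖ A ∣ ℕ.+ ∣ B ⊖ C ∣      <⟨ +-<-twice-bound ∣ B ⊖ A ∣ ∣ B ⊖ C ∣ ε (ℕtoℚ n) B≈A B≈C C-large ⟩
    ∣ C ∣                        ∎)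
    where
    open ℕ.≤-Reasoning
    C∩B≤ : ∣ C ∩ B ∣ ≤ ∣ B ⊖ A ∣
    C∩B≤ = ℕ.≤-trans (∣q∩r∣≤∣r─p∣ B A∩C≡∅) (ℕ.m≤m+n _ _)

∈-cluster⁻ : ∀ {n k} (a : Fin n → Fin k) {i x} → x ∈ cluster a i → a x ≡ i
∈-cluster⁻ a {i} {x} x∈Cᵢ = toWitness (Equivalence.from T-≡ (begin
  ⌊ a x Fin.≟ i ⌋           ≡⟨ lookup∘tabulate (λ v → ⌊ a v Fin.≟ i ⌋) x ⟨
  lookup (cluster a i) x    ≡⟨ []=⇒lookup x∈Cᵢ ⟩
  inside                    ∎))
  where open ≡-Reasoning

cluster-disjoint : ∀ {n k} (a : Fin n → Fin k) {i j} → i ≢ j → Empty (cluster a i ∩ cluster a j)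
cluster-disjoint a i≢j (x , x∈Cᵢ∩Cⱼ) =
  let x∈Cᵢ , x∈Cⱼ = x∈p∩q⁻ (cluster a _) (cluster a _) x∈Cᵢ∩Cⱼ
  in i≢j (trans (sym (∈-cluster⁻ a x∈Cᵢ)) (∈-cluster⁻ a x∈Cⱼ))

fact2 : ∀ (n k : ℕ) → 1 ≤ k →
          ∀ (d : Dist n) → IsMetric d →
          ∀ (X : CenterSet n k) → IsOptimal d X →
          ∀ (a : Fin n → Fin k) → IsClosestAssignment d (proj₁ X) a →
          ∀ (ε α : ℚ) →
          (∀ i → ℕtoℚ 2 * ε * ℕtoℚ n < ℕtoℚ ∣ cluster a i ∣) →
          1ℚ ≤ℚ α →
          ∀ (d′ : Dist n) → IsPerturbation α d d′ →
          ∀ (C′ : CenterSet n k) → IsOptimal d′ C′ →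
          ∀ (b : Fin n → Fin k) → IsClosestAssignment d′ (proj₁ C′) b →
          ∃ λ (f : (i : Fin k) → LocallyPR k d α ε (cluster a i) → Fin k) →
            (∀ i j (p : LocallyPR k d α ε (cluster a i)) (q : LocallyPR k d α ε (cluster a j)) →
               f i p ≡ f j q → i ≡ j) ×
            (∀ i (p : LocallyPR k d α ε (cluster a i)) →
               ∣ cluster a i ∣ Data.Nat.< 2 Data.Nat.* ∣ cluster a i ∩ cluster b (f i p) ∣)
fact2 n k _ d _ X _ a _ ε α large _ d′ d′-pert C′ C′-opt b b-closest = f , f-injective , f-majority
  where
  f : (i : Fin k) → LocallyPR k d α ε (cluster a i) → Fin k
  f i p = proj₁ (p d′ d′-pert C′ C′-opt b b-closest)

  f-close : ∀ i p → EpsClose ε (cluster b (f i p)) (cluster a i)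
  f-close i p = proj₂ (p d′ d′-pert C′ C′-opt b b-closest)

  f-majority : ∀ i p → ∣ cluster a i ∣ ℕ.< 2 ℕ.* ∣ cluster a i ∩ cluster b (f i p) ∣
  f-majority i p = close⇒majority ε (cluster b (f i p)) (cluster a i) (f-close i p) (large i)

  f-injective : ∀ i j p q → f i p ≡ f j q → i ≡ j
  f-injective i j p q fi≡fj with i Fin.≟ j
  ... | yes i≡j = i≡j
  ... | no i≢j = contradiction (cluster-disjoint a i≢j)
                   (close⇒intersects ε B (cluster a j) B≈Cⱼ (large j) (f-close i p))
    where
    B = cluster b (f i p)
    B≈Cⱼ : EpsClose ε B (cluster a j)
    B≈Cⱼ = subst (λ l → EpsClose ε (cluster b l) (cluster a j)) (sym fi≡fj) (f-close j q)
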